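{- Let $a\ge 2$, $\ell\ge1$, $n=a+\ell-1$, $\mu=(a,1^{\ell-1})$, $\rho=(a-1,1^\ell)$, $SF_<(\mu)=\{S\in SF(\mu):S_{1,1}<S_{1,a}\}$, $SF_<(\rho)=\{T\in SF(\rho):T_{\ell+1,1}<T_{1,1}\}$. The map $\theta:SF_<(\mu)\to SF_<(\rho)$ defined below is a bijection. Definition of $\theta$: for $S\in SF_<(\mu)$, let $u=S_{1,1}$ and let $v$ be the leftmost entry of the first row of $S$ that is $>u$. Let $\theta(S)$ be the filling of $\rho$ whose first row (read left to right, $a-1$ cells, including the corner cell $(1,1)$) is $\mathsf{arm}_u(S_{1,2}S_{1,3}\cdots S_{1,a})$, and whose first column strictly above row $1$ (cells $(2,1),\dots,(\ell+1,1)$, read bottom to top) is $\mathsf{leg}_v(S_{1,1}S_{2,1}\cdots S_{\ell,1})$.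
   Context: Fillings use French convention (row $1$ is the bottom row); $S_{i,j}$ is the entry in row $i$, column $j$. For a hook $\nu\vdash n$, $SF(\nu)$ is the set of standard fillings (bijections from the cells of $\nu$ to $\{1,\dots,n\}$). Map $\mathsf{arm}_u$: for $u\in\mathbb{N}$, it is defined on words $w=w_1\cdots w_m$ of positive integers with all letters $\neq u$ and $w_m>u$. Let $b_1<\dots<b_j$ be the indices with $w_{b_i}<u$; if there are none, $\mathsf{arm}_u(w)=w$. Otherwise: (1) draw a vertical bar immediately to the left of $w_{b_i}$ whenever $w_{b_i-1}>u$, or when $i=1$ and $b_1=1$; (2) in each resulting block (maximal segment between bars, or after the last bar) containing at least one letter $<u$, move the leftmost letter $>u$ of that block to the front of the block. The resulting word is $\mathsf{arm}_u(w)$. (E.g. $\mathsf{arm}_5(49263187)=94628317$.) Map $\mathsf{leg}_v$: for $v\in\mathbb{N}$, it is defined on words $w=w_1\cdots w_m$ with all letters $\neq v$ and $w_1<v$. Let $c_1<\dots<c_k$ be the indices with $w_{c_i}>v$; if there are none, $\mathsf{leg}_v(w)=w$. Otherwise: (1) draw a vertical bar immediately to the right of $w_{c_i}$ whenever $w_{c_i+1}<v$, or when $i=k$ and $c_k=m$; (2) in each resulting block (segment before the first bar or between consecutive bars) containing at least one letter $>v$, move the rightmost letter $<v$ of that block to the end of the block. The resulting word is $\mathsf{leg}_v(w)$. (E.g. $\mathsf{leg}_5(48731926)=87439162$.) -}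

module Defs where

open import Data.Nat using (ℕ; zero; suc; _+_; _∸_; _<_; _<ᵇ_)
open import Data.Bool using (Bool; true; false; if_then_else_)
open import Data.List using (List; []; _∷_; _++_; [_]; length; reverse; applyUpTo)
open import Data.Product using (_×_; _,_; proj₁; proj₂)
open import Data.List.Relation.Binary.Permutation.Propositional using (_↭_)
open import Relation.Binary.PropositionalEquality using (_≡_; refl)

moveGo : (ℕ → Bool) → List ℕ → List ℕ → List ℕ
moveGo p acc []       = acc
moveGo p acc (x ∷ xs) with p x
... | true  = moveGo p (acc ++ [ x ]) xs
... | false = x ∷ (acc ++ moveGo p [] xs)

-- arm_u : the blocks created by the bars are (letters<u)^+ (letters>u)^+
-- (plus an initial prefix of letters>u, left unchanged); in each such block
-- the leftmost letter >u is moved to the front of the block.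
arm : ℕ → List ℕ → List ℕ
arm u w = moveGo (λ x → x <ᵇ u) [] w

-- leg_v : the blocks are (letters<v)^+ (letters>v)^+ (plus a final suffix of
-- letters<v, unchanged); in each block the rightmost letter <v is moved to
-- the end of the block.
leg : ℕ → List ℕ → List ℕ
leg v w = reverse (moveGo (λ x → v <ᵇ x) [] (reverse w))

-- Sanity checks against the examples in the paper.
arm-example : arm 5 (4 ∷ 9 ∷ 2 ∷ 6 ∷ 3 ∷ 1 ∷ 8 ∷ 7 ∷ []) ≡ (9 ∷ 4 ∷ 6 ∷ 2 ∷ 8 ∷ 3 ∷ 1 ∷ 7 ∷ [])
arm-example = refl

leg-example : leg 5 (4 ∷ 8 ∷ 7 ∷ 3 ∷ 1 ∷ 9 ∷ 2 ∷ 6 ∷ []) ≡ (8 ∷ 7 ∷ 4 ∷ 3 ∷ 9 ∷ 1 ∷ 6 ∷ 2 ∷ [])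
leg-example = refl

-- Fillings of a hook shape (r, 1^h) (French convention).
-- A filling is given by
--   proj₁ : its first row, read left to right (r cells, (1,1),...,(1,r)),
--   proj₂ : its first column strictly above row 1, read bottom to top
--           (h cells, (2,1),...,(h+1,1)).
HookFilling : Set
HookFilling = List ℕ × List ℕ

IsStandard : ℕ → ℕ → HookFilling → Set
IsStandard r h (row , col) =
  length row ≡ r × length col ≡ h × (row ++ col) ↭ applyUpTo suc (r + h)

-- first / last letter of a word (defaults irrelevant for nonempty words)
firstOf : List ℕ → ℕ
firstOf []      = 0
firstOf (x ∷ _) = x

lastOf : List ℕ → ℕ
lastOf []       = 0
lastOf (x ∷ []) = x
lastOf (_ ∷ xs) = lastOf xs

tailOf : List ℕ → List ℕ
tailOf []       = []
tailOf (_ ∷ xs) = xs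

firstAbove : ℕ → List ℕ → ℕ
firstAbove u []       = 0
firstAbove u (x ∷ xs) = if u <ᵇ x then x else firstAbove u xs

SFμ< : ℕ → ℕ → HookFilling → Set
SFμ< a ℓ S = IsStandard a (ℓ ∸ 1) S × firstOf (proj₁ S) < lastOf (proj₁ S)

SFρ< : ℕ → ℕ → HookFilling → Set
SFρ< a ℓ T = IsStandard (a ∸ 1) ℓ T × lastOf (proj₂ T) < firstOf (proj₁ T)

θ : HookFilling → HookFilling
θ (row , col) =
  let u = firstOf row
      v = firstAbove u row
  in arm u (tailOf row) , leg v (u ∷ col)

-- Both halves of θ are instances of one word operation: given a predicate p on letters ("special"),
-- cut the word into blocks, each a run of special letters closed by one non-special letter, and
-- move the closing letter to the front of its block.  arm_u is this rotation for p = (_< u), and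
-- leg_v is its mirror image (reverse, rotate, reverse) for p = (v <_).  On words ending with a
-- non-special letter the mirror undoes the rotation, and on words starting with one the rotation
-- undoes the mirror.  Hence θ(S) determines S: v is the first letter of its row (the rotation puts
-- the leftmost letter > u in front), u = S_{1,1} is the first letter of the rotated column, and
-- the rest of the first row of S is the mirror of the row of θ(S).  This explicit inverse θ⁻¹
-- gives injectivity, and applied to T ∈ SF_<(ρ) it gives the preimage.
module Submission where

open import Defs
open import Data.Bool using (Bool; true; false; T)
open import Data.Empty using (⊥-elim)
open import Data.List using (List; []; _∷_; _++_; [_]; _∷ʳ_; length; reverse; applyUpTo; initLast; _∷ʳ′_)
open import Data.List.Properties
  using (++-assoc; ++-identityʳ; reverse-++; reverse-involutive; reverse-injective; unfold-reverse)
open import Data.List.Relation.Unary.All as All using (All; []; _∷_)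
open import Data.List.Relation.Unary.All.Properties using () renaming (++⁺ to All-++⁺)
open import Data.List.Relation.Unary.Any using (here; there)
open import Data.List.Relation.Unary.Unique.Propositional using (Unique)
open import Data.List.Relation.Unary.AllPairs using (_∷_)
open import Data.List.Relation.Unary.Unique.Propositional.Properties using (applyUpTo⁺₁; Unique[x∷xs]⇒x∉xs)
open import Data.List.Relation.Binary.Disjoint.Propositional using (Disjoint)
open import Data.List.Membership.Propositional using (_∈_; _∉_)
open import Data.List.Membership.Propositional.Properties using (∈-++⁺ˡ; ∈-++⁺ʳ)
open import Data.List.Relation.Binary.Permutation.Propositional
  using (_↭_; prep; ↭-sym; ↭-trans; ↭-reflexive; ↭⇒↭ₛ; module PermutationReasoning)
open import Data.List.Relation.Binary.Permutation.Propositional.Properties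
  using (++⁺; ++⁺ˡ; shift; ↭-reverse; ↭-length; All-resp-↭; ∈-resp-↭)
open import Data.List.Relation.Binary.Permutation.Setoid.Properties using (Unique-resp-↭)
open import Data.Nat using (ℕ; zero; suc; _+_; _<_; _≮_; _<ᵇ_; _≤_)
open import Data.Nat.Properties using (<ᵇ⇒<; <⇒<ᵇ; <⇒≯; ≮⇒≥; ≤∧≢⇒<; n≮n; <⇒≢; +-suc; suc-injective)
open import Data.Product using (_×_; _,_; proj₁; proj₂; Σ)
open import Data.Unit using (tt)
open import Function using (_∘_)
open import Relation.Binary.PropositionalEquality
  using (_≡_; _≢_; refl; sym; trans; cong; cong₂; subst; setoid; module ≡-Reasoning)

<ᵇ≡true⇒< : ∀ {m n} → (m <ᵇ n) ≡ true → m < n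
<ᵇ≡true⇒< {m} {n} e = <ᵇ⇒< m n (subst T (sym e) tt)

<ᵇ≡false⇒≮ : ∀ {m n} → (m <ᵇ n) ≡ false → m ≮ n
<ᵇ≡false⇒≮ e m<n = subst T e (<⇒<ᵇ m<n)

≮⇒<ᵇ≡false : ∀ {m n} → m ≮ n → (m <ᵇ n) ≡ false
≮⇒<ᵇ≡false {m} {n} m≮n with m <ᵇ n in e
... | true  = ⊥-elim (m≮n (<ᵇ≡true⇒< e))
... | false = refl

≮∧≢⇒> : ∀ {m n} → m ≮ n → m ≢ n → n < m
≮∧≢⇒> m≮n m≢n = ≤∧≢⇒< (≮⇒≥ m≮n) (m≢n ∘ sym)

firstOf-∈ : ∀ {x w} → x ∈ w → firstOf w ∈ w
firstOf-∈ (here _)  = here refl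
firstOf-∈ (there _) = here refl

firstOf-∷-tailOf : ∀ {x w} → x ∈ w → firstOf w ∷ tailOf w ≡ w
firstOf-∷-tailOf (here _)  = refl
firstOf-∷-tailOf (there _) = refl

lastOf-∷ : ∀ {x} y {w} → x ∈ w → lastOf (y ∷ w) ≡ lastOf w
lastOf-∷ y (here _)  = refl
lastOf-∷ y (there _) = refl

lastOf-∷ʳ : ∀ w (x : ℕ) → lastOf (w ∷ʳ x) ≡ x
lastOf-∷ʳ []          x = refl
lastOf-∷ʳ (y ∷ [])    x = refl
lastOf-∷ʳ (y ∷ z ∷ w) x = lastOf-∷ʳ (z ∷ w) x

lastOf-reverse : ∀ w → lastOf (reverse w) ≡ firstOf w
lastOf-reverse []      = refl
lastOf-reverse (x ∷ w) = trans (cong lastOf (unfold-reverse x w)) (lastOf-∷ʳ (reverse w) x)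

module _ (p : ℕ → Bool) where

  Special : ℕ → Set
  Special x = p x ≡ true

  data Blocks : List ℕ → Set where
    []    : Blocks []
    block : ∀ {B x w} → All Special B → p x ≡ false → Blocks w → Blocks (B ++ x ∷ w)

module Rotation (p : ℕ → Bool) where

  rotate : List ℕ → List ℕ
  rotate = moveGo p []

  mirror : List ℕ → List ℕ
  mirror w = reverse (rotate (reverse w))

  moveGo-specials : ∀ acc {B} w → All (Special p) B → moveGo p acc (B ++ w) ≡ moveGo p (acc ++ B) w
  moveGo-specials acc w [] = cong (λ a → moveGo p a w) (sym (++-identityʳ acc))
  moveGo-specials acc w (_∷_ {x} {B} px sB) rewrite px =
    trans (moveGo-specials (acc ++ [ x ]) w sB) (cong (λ a → moveGo p a w) (++-assoc acc [ x ] B))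

  moveGo-↭ : ∀ acc w → moveGo p acc w ↭ acc ++ w
  moveGo-↭ acc [] = ↭-reflexive (sym (++-identityʳ acc))
  moveGo-↭ acc (x ∷ w) with p x
  ... | true  = ↭-trans (moveGo-↭ (acc ++ [ x ]) w) (↭-reflexive (++-assoc acc [ x ] w))
  ... | false = ↭-trans (prep x (++⁺ˡ acc (moveGo-↭ [] w))) (↭-sym (shift x acc w))

  rotate-↭ : ∀ w → rotate w ↭ w
  rotate-↭ = moveGo-↭ []

  mirror-↭ : ∀ w → mirror w ↭ w
  mirror-↭ w = ↭-trans (↭-reverse _) (↭-trans (rotate-↭ (reverse w)) (↭-reverse w))

  rotate-block : ∀ {B x} w → All (Special p) B → p x ≡ false → rotate (B ++ x ∷ w) ≡ x ∷ B ++ rotate w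
  rotate-block {B} {x} w sB px rewrite moveGo-specials [] (x ∷ w) sB | px = refl

  blocks-∷ʳ : ∀ {x} w → p x ≡ false → Blocks p (w ∷ʳ x)
  blocks-∷ʳ {x} w px = after [] w []
    where
    after : ∀ B w → All (Special p) B → Blocks p (B ++ w ∷ʳ x)
    after B []      sB = block sB px []
    after B (y ∷ w) sB with p y in py
    ... | true  = subst (Blocks p) (++-assoc B [ y ] _) (after (B ∷ʳ y) w (All-++⁺ sB (py ∷ [])))
    ... | false = block sB py (after [] w [])

  ++-blocks : ∀ {u w} → Blocks p u → Blocks p w → Blocks p (u ++ w)
  ++-blocks []                                bw = bw
  ++-blocks (block {B} {x} {v} sB px bv) bw =
    subst (Blocks p) (sym (++-assoc B (x ∷ v) _)) (block sB px (++-blocks bv bw))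

  rotate-++ : ∀ {u} w → Blocks p u → rotate (u ++ w) ≡ rotate u ++ rotate w
  rotate-++ w [] = refl
  rotate-++ w (block {B} {x} {v} sB px bv) = begin
    rotate ((B ++ x ∷ v) ++ w)        ≡⟨ cong rotate (++-assoc B (x ∷ v) w) ⟩
    rotate (B ++ x ∷ v ++ w)          ≡⟨ rotate-block (v ++ w) sB px ⟩
    x ∷ B ++ rotate (v ++ w)          ≡⟨ cong (λ r → x ∷ B ++ r) (rotate-++ w bv) ⟩
    x ∷ B ++ rotate v ++ rotate w     ≡⟨ cong (x ∷_) (sym (++-assoc B (rotate v) (rotate w))) ⟩
    (x ∷ B ++ rotate v) ++ rotate w   ≡⟨ cong (_++ rotate w) (sym (rotate-block v sB px)) ⟩
    rotate (B ++ x ∷ v) ++ rotate w   ∎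
    where open ≡-Reasoning

  reverse-rotate-block : ∀ {B x} w → All (Special p) B → p x ≡ false →
                         reverse (rotate (B ++ x ∷ w)) ≡ reverse (rotate w) ++ reverse B ∷ʳ x
  reverse-rotate-block {B} {x} w sB px = begin
    reverse (rotate (B ++ x ∷ w))        ≡⟨ cong reverse (rotate-block w sB px) ⟩
    reverse (x ∷ B ++ rotate w)          ≡⟨ unfold-reverse x (B ++ rotate w) ⟩
    reverse (B ++ rotate w) ∷ʳ x         ≡⟨ cong (_∷ʳ x) (reverse-++ B (rotate w)) ⟩
    (reverse (rotate w) ++ reverse B) ∷ʳ x ≡⟨ ++-assoc (reverse (rotate w)) (reverse B) [ x ] ⟩
    reverse (rotate w) ++ reverse B ∷ʳ x ∎
    where open ≡-Reasoning

  reverse-specials : ∀ {B} → All (Special p) B → All (Special p) (reverse B)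
  reverse-specials sB = All-resp-↭ (↭-sym (↭-reverse _)) sB

  blocks-reverse-rotate : ∀ {w} → Blocks p w → Blocks p (reverse (rotate w))
  blocks-reverse-rotate [] = []
  blocks-reverse-rotate (block {w = w} sB px bw) =
    subst (Blocks p) (sym (reverse-rotate-block w sB px))
      (++-blocks (blocks-reverse-rotate bw) (block (reverse-specials sB) px []))

  mirror-rotate : ∀ {w} → Blocks p w → mirror (rotate w) ≡ w
  mirror-rotate [] = refl
  mirror-rotate (block {B} {x} {w} sB px bw) = begin
    reverse (rotate (reverse (rotate (B ++ x ∷ w))))
      ≡⟨ cong (reverse ∘ rotate) (reverse-rotate-block w sB px) ⟩
    reverse (rotate (reverse (rotate w) ++ reverse B ∷ʳ x))
      ≡⟨ cong reverse (rotate-++ (reverse B ∷ʳ x) (blocks-reverse-rotate bw)) ⟩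
    reverse (rotate (reverse (rotate w)) ++ rotate (reverse B ∷ʳ x))
      ≡⟨ cong (λ r → reverse (rotate (reverse (rotate w)) ++ r)) (rotate-∷ʳ (reverse-specials sB) px) ⟩
    reverse (rotate (reverse (rotate w)) ++ x ∷ reverse B)
      ≡⟨ reverse-++ (rotate (reverse (rotate w))) (x ∷ reverse B) ⟩
    reverse (x ∷ reverse B) ++ mirror (rotate w)
      ≡⟨ cong₂ _++_ (trans (unfold-reverse x (reverse B)) (cong (_∷ʳ x) (reverse-involutive B)))
                    (mirror-rotate bw) ⟩
    B ∷ʳ x ++ w
      ≡⟨ ++-assoc B [ x ] w ⟩
    B ++ x ∷ w ∎
    where
    open ≡-Reasoning
    rotate-∷ʳ : ∀ {B} → All (Special p) B → p x ≡ false → rotate (B ∷ʳ x) ≡ x ∷ B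
    rotate-∷ʳ {B} sB px = trans (rotate-block [] sB px) (cong (x ∷_) (++-identityʳ B))

  rotate-mirror : ∀ {w} → Blocks p (reverse w) → rotate (mirror w) ≡ w
  rotate-mirror bw = reverse-injective (mirror-rotate bw)

  blocks-mirror : ∀ {w} → Blocks p (reverse w) → Blocks p (mirror w)
  blocks-mirror bw = blocks-reverse-rotate bw

  -- The hypothesis x ∈ w only excludes w = [], where firstOf and lastOf return the junk value 0.
  firstOf-rotate : ∀ {w x} → Blocks p w → x ∈ w →
                   p (firstOf (rotate w)) ≡ false × firstOf (rotate w) ∈ w
  firstOf-rotate {w} bw x∈w =
    nonspecial bw x∈w , ∈-resp-↭ (rotate-↭ w) (firstOf-∈ (∈-resp-↭ (↭-sym (rotate-↭ w)) x∈w))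
    where
    nonspecial : ∀ {w x} → Blocks p w → x ∈ w → p (firstOf (rotate w)) ≡ false
    nonspecial (block {w = w} sB px _) _ =
      subst (λ r → p (firstOf r) ≡ false) (sym (rotate-block w sB px)) px

  lastOf-mirror : ∀ {w x} → Blocks p (reverse w) → x ∈ w →
                  p (lastOf (mirror w)) ≡ false × lastOf (mirror w) ∈ w
  lastOf-mirror {w} bw x∈w
    rewrite lastOf-reverse (rotate (reverse w))
    with firstOf-rotate bw (∈-resp-↭ (↭-sym (↭-reverse w)) x∈w)
  ... | nonspecial , ∈rw = nonspecial , ∈-resp-↭ (↭-reverse w) ∈rw

firstAbove-above : ∀ {u x w} → u < x → x ∈ w → u < firstAbove u w × firstAbove u w ∈ w
firstAbove-above {u} {w = y ∷ w} u<x x∈w with u <ᵇ y in e | x∈w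
... | true  | _          = <ᵇ≡true⇒< e , here refl
... | false | here refl  = ⊥-elim (<ᵇ≡false⇒≮ e u<x)
... | false | there x∈w′ with firstAbove-above u<x x∈w′
...   | u<v , v∈w = u<v , there v∈w

firstAbove-∷ : ∀ {u x} w → u < x → firstAbove u (x ∷ w) ≡ x
firstAbove-∷ {u} {x} w u<x with u <ᵇ x in e
... | true  = refl
... | false = ⊥-elim (<ᵇ≡false⇒≮ e u<x)

firstAbove-self : ∀ u w → firstAbove u (u ∷ w) ≡ firstAbove u w
firstAbove-self u w rewrite ≮⇒<ᵇ≡false (n≮n u) = refl

firstAbove-++ : ∀ {u B} w → All (Special (_<ᵇ u)) B → firstAbove u (B ++ w) ≡ firstAbove u w
firstAbove-++ w [] = refl
firstAbove-++ {u} w (_∷_ {b} b<u B<u) with u <ᵇ b in e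
... | true  = ⊥-elim (<⇒≯ (<ᵇ≡true⇒< {b} {u} b<u) (<ᵇ≡true⇒< e))
... | false = firstAbove-++ w B<u

firstOf-arm : ∀ {u w} → Blocks (_<ᵇ u) w → u ∉ w → firstOf (arm u w) ≡ firstAbove u w
firstOf-arm [] _ = refl
firstOf-arm {u} (block {B} {x} {w} B<u x≮u bw) u∉ = begin
  firstOf (arm u (B ++ x ∷ w))  ≡⟨ cong firstOf (rotate-block w B<u x≮u) ⟩
  x                             ≡⟨ sym (firstAbove-∷ w u<x) ⟩
  firstAbove u (x ∷ w)          ≡⟨ sym (firstAbove-++ (x ∷ w) B<u) ⟩
  firstAbove u (B ++ x ∷ w)     ∎
  where
  open ≡-Reasoning
  open Rotation (_<ᵇ u)
  u<x : u < x
  u<x = ≮∧≢⇒> (<ᵇ≡false⇒≮ x≮u) (λ x≡u → u∉ (∈-++⁺ʳ B (here (sym x≡u))))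

unique-++⇒disjoint : ∀ {xs ys : List ℕ} → Unique (xs ++ ys) → Disjoint xs ys
unique-++⇒disjoint {x ∷ xs} (x∉ ∷ _) (here refl , y∈ys) = All.lookup x∉ (∈-++⁺ʳ xs y∈ys) refl
unique-++⇒disjoint {x ∷ xs} (_ ∷ u)  (there v∈xs , v∈ys) = unique-++⇒disjoint u (v∈xs , v∈ys)

↭-applyUpTo⇒Unique : ∀ {n xs} → xs ↭ applyUpTo suc n → Unique xs
↭-applyUpTo⇒Unique {n} xs↭ =
  Unique-resp-↭ (setoid ℕ) (↭⇒↭ₛ (↭-sym xs↭)) (applyUpTo⁺₁ suc n (λ i<j _ → <⇒≢ i<j ∘ suc-injective))

θ⁻¹ : HookFilling → HookFilling
θ⁻¹ (row , col) =
  let v = firstOf row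
      w = Rotation.rotate (v <ᵇ_) col
      u = firstOf w
  in u ∷ Rotation.mirror (_<ᵇ u) row , tailOf w

θ⁻¹-unfold : ∀ row col {v u c} → firstOf row ≡ v → Rotation.rotate (v <ᵇ_) col ≡ u ∷ c →
             θ⁻¹ (row , col) ≡ (u ∷ Rotation.mirror (_<ᵇ u) row , c)
θ⁻¹-unfold row col refl e = cong (λ w → firstOf w ∷ Rotation.mirror (_<ᵇ firstOf w) row , tailOf w) e

data SourceView : HookFilling → Set where
  source : ∀ u R t c → SourceView (u ∷ R ∷ʳ t , c)

sourceView : ∀ {a ℓ} S → SFμ< a ℓ S → SourceView S
sourceView ([] , c) (_ , ())
sourceView (u ∷ r , c) (_ , u<last) with initLast r
... | []      = ⊥-elim (n≮n u u<last)
... | R ∷ʳ′ t = source u R t c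

data TargetView : HookFilling → Set where
  target : ∀ v rr C z → TargetView (v ∷ rr , C ∷ʳ z)

targetView : ∀ {a k} T → SFρ< a (suc k) T → TargetView T
targetView ([] , col) (_ , ())
targetView (v ∷ rr , col) ((_ , length-col , _) , _) with initLast col
targetView (v ∷ rr , .[]) ((_ , () , _) , _) | []
... | C ∷ʳ′ z = target v rr C z

module Bijection (m k : ℕ) where

  module Source (u : ℕ) (R : List ℕ) (t : ℕ) (c : List ℕ)
                (h : SFμ< (suc m) (suc k) (u ∷ R ∷ʳ t , c)) where

    tail : List ℕ
    tail = R ∷ʳ t

    v : ℕ
    v = firstAbove u (u ∷ tail)

    open Rotation (_<ᵇ u) using () renaming (rotate-↭ to arm-↭; mirror-rotate to mirror-arm)
    open Rotation (v <ᵇ_) using ()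
      renaming (mirror-↭ to leg-↭; rotate-mirror to rotate-leg; lastOf-mirror to lastOf-leg)

    entries : (u ∷ tail) ++ c ↭ applyUpTo suc (suc m + k)
    entries = proj₂ (proj₂ (proj₁ h))

    distinct : Unique ((u ∷ tail) ++ c)
    distinct = ↭-applyUpTo⇒Unique entries

    u∉tail : u ∉ tail
    u∉tail = Unique[x∷xs]⇒x∉xs distinct ∘ ∈-++⁺ˡ

    u<t : u < t
    u<t = subst (u <_) (lastOf-∷ʳ (u ∷ R) t) (proj₂ h)

    tail-blocks : Blocks (_<ᵇ u) tail
    tail-blocks = Rotation.blocks-∷ʳ (_<ᵇ u) R (≮⇒<ᵇ≡false (<⇒≯ u<t))

    firstOf-arm-tail : firstOf (arm u tail) ≡ v
    firstOf-arm-tail = trans (firstOf-arm tail-blocks u∉tail) (sym (firstAbove-self u tail))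

    u<v×v∈tail : u < v × v ∈ tail
    u<v×v∈tail = subst (λ x → u < x × x ∈ tail) (sym (firstAbove-self u tail))
                   (firstAbove-above u<t (∈-++⁺ʳ R (here refl)))

    u<v : u < v
    u<v = proj₁ u<v×v∈tail

    v∉column : v ∉ u ∷ c
    v∉column (here v≡u)  = <⇒≢ u<v (sym v≡u)
    v∉column (there v∈c) = unique-++⇒disjoint distinct (there (proj₂ u<v×v∈tail) , v∈c)

    column-blocks : Blocks (v <ᵇ_) (reverse (u ∷ c))
    column-blocks = subst (Blocks (v <ᵇ_)) (sym (unfold-reverse u c))
                      (Rotation.blocks-∷ʳ (v <ᵇ_) (reverse c) (≮⇒<ᵇ≡false (<⇒≯ u<v)))

    lastOf-leg<v : lastOf (leg v (u ∷ c)) < v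
    lastOf-leg<v with lastOf-leg column-blocks (here refl)
    ... | v≮last , last∈column =
      ≮∧≢⇒> (<ᵇ≡false⇒≮ v≮last) (λ v≡last → v∉column (subst (_∈ u ∷ c) (sym v≡last) last∈column))

    θ-SFρ< : SFρ< (suc m) (suc k) (θ (u ∷ tail , c))
    θ-SFρ< = (length-arm , length-leg , θ-entries) ,
             subst (lastOf (leg v (u ∷ c)) <_) (sym firstOf-arm-tail) lastOf-leg<v
      where
      length-arm : length (arm u tail) ≡ m
      length-arm = trans (↭-length (arm-↭ tail)) (suc-injective (proj₁ (proj₁ h)))
      length-leg : length (leg v (u ∷ c)) ≡ suc k
      length-leg = trans (↭-length (leg-↭ (u ∷ c))) (cong suc (proj₁ (proj₂ (proj₁ h))))
      θ-entries : arm u tail ++ leg v (u ∷ c) ↭ applyUpTo suc (m + suc k)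
      θ-entries = begin
        arm u tail ++ leg v (u ∷ c)  ↭⟨ ++⁺ (arm-↭ tail) (leg-↭ (u ∷ c)) ⟩
        tail ++ u ∷ c                ↭⟨ shift u tail c ⟩
        u ∷ tail ++ c                ↭⟨ entries ⟩
        applyUpTo suc (suc m + k)    ≡⟨ cong (applyUpTo suc) (sym (+-suc m k)) ⟩
        applyUpTo suc (m + suc k)    ∎
        where open PermutationReasoning

    θ⁻¹-θ : θ⁻¹ (θ (u ∷ tail , c)) ≡ (u ∷ tail , c)
    θ⁻¹-θ = trans (θ⁻¹-unfold (arm u tail) (leg v (u ∷ c)) firstOf-arm-tail (rotate-leg column-blocks))
                  (cong (λ r → u ∷ r , c) (mirror-arm tail-blocks))

  module Target (v : ℕ) (rr C : List ℕ) (z : ℕ)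
                (h : SFρ< (suc m) (suc k) (v ∷ rr , C ∷ʳ z)) where

    row col : List ℕ
    row = v ∷ rr
    col = C ∷ʳ z

    open Rotation (v <ᵇ_) using ()
      renaming (rotate to unleg; rotate-↭ to unleg-↭; mirror-rotate to leg-unleg)

    w : List ℕ
    w = unleg col

    u : ℕ
    u = firstOf w

    c : List ℕ
    c = tailOf w

    open Rotation (_<ᵇ u) using ()
      renaming (mirror to unarm; mirror-↭ to unarm-↭; rotate-mirror to arm-unarm; lastOf-mirror to lastOf-unarm)

    tail : List ℕ
    tail = unarm row

    entries : row ++ col ↭ applyUpTo suc (m + suc k)
    entries = proj₂ (proj₂ (proj₁ h))

    distinct : Unique (row ++ col)
    distinct = ↭-applyUpTo⇒Unique entries

    z<v : z < v
    z<v = subst (_< v) (lastOf-∷ʳ C z) (proj₂ h)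

    col-blocks : Blocks (v <ᵇ_) col
    col-blocks = Rotation.blocks-∷ʳ (v <ᵇ_) C (≮⇒<ᵇ≡false (<⇒≯ z<v))

    z∈col : z ∈ col
    z∈col = ∈-++⁺ʳ C (here refl)

    u∷c≡w : u ∷ c ≡ w
    u∷c≡w = firstOf-∷-tailOf (∈-resp-↭ (↭-sym (unleg-↭ col)) z∈col)

    v≮u×u∈col : (v <ᵇ u) ≡ false × u ∈ col
    v≮u×u∈col = Rotation.firstOf-rotate (v <ᵇ_) col-blocks z∈col

    u∈col : u ∈ col
    u∈col = proj₂ v≮u×u∈col

    row-col-disjoint : ∀ {x} → x ∈ row → x ∉ col
    row-col-disjoint x∈row x∈col = unique-++⇒disjoint distinct (x∈row , x∈col)

    u<v : u < v
    u<v = ≮∧≢⇒> {v} {u} (<ᵇ≡false⇒≮ (proj₁ v≮u×u∈col))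
            (λ v≡u → row-col-disjoint (here (sym v≡u)) u∈col)

    row-blocks : Blocks (_<ᵇ u) (reverse row)
    row-blocks = subst (Blocks (_<ᵇ u)) (sym (unfold-reverse v rr))
                   (Rotation.blocks-∷ʳ (_<ᵇ u) (reverse rr) (≮⇒<ᵇ≡false (<⇒≯ u<v)))

    tail-blocks : Blocks (_<ᵇ u) tail
    tail-blocks = Rotation.blocks-mirror (_<ᵇ u) {row} row-blocks

    u∉tail : u ∉ tail
    u∉tail u∈tail = row-col-disjoint (∈-resp-↭ (unarm-↭ row) u∈tail) u∈col

    u<lastOf : u < lastOf (u ∷ tail)
    u<lastOf with lastOf-unarm row-blocks (here refl)
    ... | last≮u , last∈row =
      subst (u <_) (sym (lastOf-∷ u (∈-resp-↭ (↭-sym (unarm-↭ row)) (here refl))))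
        (≮∧≢⇒> (<ᵇ≡false⇒≮ last≮u)
          (λ last≡u → row-col-disjoint last∈row (subst (_∈ col) (sym last≡u) u∈col)))

    θ⁻¹-SFμ< : SFμ< (suc m) (suc k) (θ⁻¹ (row , col))
    θ⁻¹-SFμ< = (length-row , length-col , θ⁻¹-entries) , u<lastOf
      where
      length-row : length (u ∷ tail) ≡ suc m
      length-row = cong suc (trans (↭-length (unarm-↭ row)) (proj₁ (proj₁ h)))
      length-col : length c ≡ k
      length-col = suc-injective (begin
        length (u ∷ c)  ≡⟨ cong length u∷c≡w ⟩
        length w        ≡⟨ ↭-length (unleg-↭ col) ⟩
        length col      ≡⟨ proj₁ (proj₂ (proj₁ h)) ⟩
        suc k           ∎)
        where open ≡-Reasoning
      θ⁻¹-entries : (u ∷ tail) ++ c ↭ applyUpTo suc (suc m + k)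
      θ⁻¹-entries = begin
        u ∷ tail ++ c              ↭⟨ shift u tail c ⟨
        tail ++ u ∷ c              ↭⟨ ++⁺ (unarm-↭ row) (↭-trans (↭-reflexive u∷c≡w) (unleg-↭ col)) ⟩
        row ++ col                 ↭⟨ entries ⟩
        applyUpTo suc (m + suc k)  ≡⟨ cong (applyUpTo suc) (+-suc m k) ⟩
        applyUpTo suc (suc m + k)  ∎
        where open PermutationReasoning

    θ-θ⁻¹ : θ (θ⁻¹ (row , col)) ≡ (row , col)
    θ-θ⁻¹ = cong₂ _,_ arm-tail (begin
      leg (firstAbove u (u ∷ tail)) (u ∷ c)  ≡⟨ cong (λ x → leg x (u ∷ c)) firstAbove≡v ⟩
      leg v (u ∷ c)                          ≡⟨ cong (leg v) u∷c≡w ⟩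
      leg v (unleg col)                      ≡⟨ leg-unleg col-blocks ⟩
      col                                    ∎)
      where
      open ≡-Reasoning
      arm-tail : arm u tail ≡ row
      arm-tail = arm-unarm row-blocks
      firstAbove≡v : firstAbove u (u ∷ tail) ≡ v
      firstAbove≡v = begin
        firstAbove u (u ∷ tail)  ≡⟨ firstAbove-self u tail ⟩
        firstAbove u tail        ≡⟨ firstOf-arm {w = tail} tail-blocks u∉tail ⟨
        firstOf (arm u tail)     ≡⟨ cong firstOf arm-tail ⟩
        v                        ∎

  θ-SFρ< : ∀ S → SFμ< (suc m) (suc k) S → SFρ< (suc m) (suc k) (θ S)
  θ-SFρ< S h with sourceView {suc m} {suc k} S h
  ... | source u R t c = Source.θ-SFρ< u R t c h

  θ⁻¹-θ : ∀ S → SFμ< (suc m) (suc k) S → θ⁻¹ (θ S) ≡ S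
  θ⁻¹-θ S h with sourceView {suc m} {suc k} S h
  ... | source u R t c = Source.θ⁻¹-θ u R t c h

  θ⁻¹-SFμ< : ∀ T → SFρ< (suc m) (suc k) T → SFμ< (suc m) (suc k) (θ⁻¹ T)
  θ⁻¹-SFμ< T h with targetView {suc m} {k} T h
  ... | target v rr C z = Target.θ⁻¹-SFμ< v rr C z h

  θ-θ⁻¹ : ∀ T → SFρ< (suc m) (suc k) T → θ (θ⁻¹ T) ≡ T
  θ-θ⁻¹ T h with targetView {suc m} {k} T h
  ... | target v rr C z = Target.θ-θ⁻¹ v rr C z h

mainTheorem3 : (a ℓ : ℕ) → 2 ≤ a → 1 ≤ ℓ →
    ((S : HookFilling) → SFμ< a ℓ S → SFρ< a ℓ (θ S))
    × ((S S′ : HookFilling) → SFμ< a ℓ S → SFμ< a ℓ S′ → θ S ≡ θ S′ → S ≡ S′)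
    × ((T : HookFilling) → SFρ< a ℓ T → Σ HookFilling (λ S → SFμ< a ℓ S × θ S ≡ T))
mainTheorem3 zero    _       ()  _
mainTheorem3 (suc m) zero    _   ()
mainTheorem3 (suc m) (suc k) _   _  = θ-SFρ< , θ-injective , θ-surjective
  where
  open Bijection m k
  θ-injective : ∀ S S′ → SFμ< (suc m) (suc k) S → SFμ< (suc m) (suc k) S′ → θ S ≡ θ S′ → S ≡ S′
  θ-injective S S′ h h′ e = trans (sym (θ⁻¹-θ S h)) (trans (cong θ⁻¹ e) (θ⁻¹-θ S′ h′))
  θ-surjective : ∀ T → SFρ< (suc m) (suc k) T → Σ HookFilling (λ S → SFμ< (suc m) (suc k) S × θ S ≡ T)
  θ-surjective T h = θ⁻¹ T , θ⁻¹-SFμ< T h , θ-θ⁻¹ T h
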